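{- Let $m=pq$ be the product of two distinct odd primes $p,q$. Then every $S_m$-decoding polynomial contains at least three monomials.
   Context: Let $t$ be the multiplicative order of $2$ modulo $m$, and let $\gamma_m\in\mathbb{F}_{2^{t}}^{*}$ be a primitive $m$-th root of unity. The canonical set of $m$ is $S_m=\{s_{11},s_{01},s_{10}\}\subseteq\mathbb{Z}_m$, where $s_{\sigma_1\sigma_2}\in\mathbb{Z}_m$ is the unique residue with $s_{\sigma_1\sigma_2}\equiv\sigma_1 \pmod p$ and $s_{\sigma_1\sigma_2}\equiv\sigma_2\pmod q$ (so $s_{11}=1$). An $S_m$-decoding polynomial is a polynomial $P(X)\in\mathbb{F}_{2^{t}}[X]$ with $P(\gamma_m^{s})=0$ for all $s\in S_m$ and $P(1)=1$. -}

module Defs where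

open import Level using (Level)
open import Data.Nat as ℕ using (ℕ; zero; suc; _<_; _≤_)
open import Data.Nat.Divisibility using (_∣_)
open import Data.Fin as Fin using (Fin)
open import Data.List using (List; []; _∷_; length; lookup)
open import Data.Product using (Σ; _×_; ∃; ∃-syntax)
open import Data.Sum using (_⊎_)
open import Relation.Nullary using (¬_)
open import Relation.Binary.PropositionalEquality using (_≡_)
open import Algebra.Bundles using (CommutativeRing)

-- a ≡ b (mod n), written out for residues b
_≡_[mod_] : ℕ → ℕ → ℕ → Set
a ≡ b [mod n ] = ∃[ k ] (a ≡ k ℕ.* n ℕ.+ b)

Odd : ℕ → Set
Odd n = ¬ (2 ∣ n)

IsMultOrderOf2 : (m t : ℕ) → Set
IsMultOrderOf2 m t =
  (0 < t) × m ∣ (2 ℕ.^ t ℕ.∸ 1)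
  × (∀ k → 0 < k → k < t → ¬ (m ∣ (2 ℕ.^ k ℕ.∸ 1)))

-- s ∈ S_m  for m = p q :  s ∈ ℤ_m (represented by 0 ≤ s < m) with
-- (s mod p, s mod q) ∈ {(1,1), (0,1), (1,0)}
InCanonicalSet : (p q s : ℕ) → Set
InCanonicalSet p q s =
  s < p ℕ.* q ×
  (  (s ≡ 1 [mod p ] × s ≡ 1 [mod q ])
   ⊎ (s ≡ 0 [mod p ] × s ≡ 1 [mod q ])
   ⊎ (s ≡ 1 [mod p ] × s ≡ 0 [mod q ]))

module _ {c ℓ : Level} (R : CommutativeRing c ℓ) where
  open CommutativeRing R

  IsField : Set (c Level.⊔ ℓ)
  IsField = ¬ (0# ≈ 1#) × (∀ x → ¬ (x ≈ 0#) → ∃[ y ] (x * y ≈ 1#))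

  HasChar2 : Set ℓ
  HasChar2 = 1# + 1# ≈ 0#

  HasCardinality : ℕ → Set (c Level.⊔ ℓ)
  HasCardinality n = Σ (Fin n → Carrier) λ f →
    (∀ x → ∃[ i ] (f i ≈ x)) × (∀ i j → f i ≈ f j → i ≡ j)

  pow : Carrier → ℕ → Carrier
  pow x zero    = 1#
  pow x (suc n) = x * pow x n

  IsPrimitiveRoot : ℕ → Carrier → Set ℓ
  IsPrimitiveRoot m γ = pow γ m ≈ 1# × (∀ k → 0 < k → k < m → ¬ (pow γ k ≈ 1#))

  -- polynomials as coefficient lists (constant term first): [c₀, c₁, …] = Σ cᵢ Xⁱ
  Poly : Set c
  Poly = List Carrier

  eval : Poly → Carrier → Carrier
  eval []       x = 0#
  eval (a ∷ as) x = a + x * eval as x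

  IsDecodingPoly : (p q : ℕ) → Carrier → Poly → Set ℓ
  IsDecodingPoly p q γ P =
    (∀ s → InCanonicalSet p q s → eval P (pow γ s) ≈ 0#) × (eval P 1# ≈ 1#)

  AtLeastThreeMonomials : Poly → Set ℓ
  AtLeastThreeMonomials P =
    ∃[ i ] ∃[ j ] ∃[ k ] (i Fin.< j × j Fin.< k ×
      ¬ (lookup P i ≈ 0#) × ¬ (lookup P j ≈ 0#) × ¬ (lookup P k ≈ 0#))

module Submission where

-- S_m contains 1 together with the lifts a of (0 mod p, 1 mod q) and b of
-- (1 mod p, 0 mod q), and a + b = pq + 1. Suppose P has at most two monomials,
-- i.e. P(x) = xⁿ (u + v xᵉ). Since γ is a unit and -1 = 1, the roots γ, γᵃ, γᵇ give
-- u = v z = v zᵃ = v zᵇ for z = γᵉ, while P(1) = 1 gives u + v = 1, so v ≠ 0.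
-- Then zᵃ = zᵇ = z, hence z² = z^(a+b) = z^(pq+1) = z and z = 1, so u = v and
-- u + v = 0 ≠ 1.

open import Defs
open import Algebra.Bundles using (CommutativeRing)

module CanonicalSetArithmetic where
  open import Data.Nat
  open import Data.Nat.Properties
  open import Data.Nat.DivMod
  open import Data.Nat.Coprimality using (Coprime; coprime-Bézout)
  open import Data.Nat.GCD using (module Bézout)
  open import Data.Nat.Primality using (Prime; prime⇒irreducible; prime⇒nonTrivial)
  open import Data.Nat.Tactic.RingSolver using (solve-∀)
  open import Data.Product using (∃; ∃₂; _×_; _,_)
  open import Data.Sum using (inj₁; inj₂)
  open import Data.Empty using (⊥-elim)
  open import Relation.Nullary using (¬_)
  open import Relation.Binary.PropositionalEquality

  distinct-primes-coprime : ∀ {p q} → Prime p → Prime q → ¬ p ≡ q → Coprime p q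
  distinct-primes-coprime p-prime q-prime p≢q (d∣p , d∣q)
    with prime⇒irreducible p-prime d∣p
  ... | inj₁ d≡1 = d≡1
  ... | inj₂ refl with prime⇒irreducible q-prime d∣q
  ...   | inj₁ p≡1 = ⊥-elim (nonTrivial⇒≢1 {{prime⇒nonTrivial p-prime}} p≡1)
  ...   | inj₂ p≡q = ⊥-elim (p≢q p≡q)

  Lift₀₁ : ℕ → ℕ → ℕ → Set
  Lift₀₁ p q a = a < p * q × a ≡ 0 [mod p ] × a ≡ 1 [mod q ]

  -- A Bézout relation x p = 1 + y q makes (x mod q) p the lift of (0, 1).
  bézout⇒lift : ∀ p q x y → .{{NonTrivial p}} → .{{NonTrivial q}} →
                x * p ≡ 1 + y * q → ∃ (Lift₀₁ p q)
  bézout⇒lift p q x y xp≡1+yq = a , a<pq , (x % q , sym (+-identityʳ a)) , (a / q , a≡a/q*q+1)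
    where
    instance
      p≢0 : NonZero p
      p≢0 = nonTrivial⇒nonZero p
      q≢0 : NonZero q
      q≢0 = nonTrivial⇒nonZero q
    a : ℕ
    a = x % q * p

    a<pq : a < p * q
    a<pq = subst (a <_) (*-comm q p) (*-monoˡ-< p (m%n<n x q))

    xp≡a+kq : x * p ≡ a + x / q * p * q
    xp≡a+kq = trans (cong (_* p) (m≡m%n+[m/n]*n x q)) (regroup (x % q) (x / q) p q)
      where
      regroup : ∀ r d p q → (r + d * q) * p ≡ r * p + d * p * q
      regroup = solve-∀

    a%q≡1 : a % q ≡ 1
    a%q≡1 = begin
      a % q                    ≡⟨ sym ([m+kn]%n≡m%n a (x / q * p) q) ⟩
      (a + x / q * p * q) % q  ≡⟨ cong (_% q) (sym xp≡a+kq) ⟩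
      x * p % q                ≡⟨ cong (_% q) xp≡1+yq ⟩
      (1 + y * q) % q          ≡⟨ [m+kn]%n≡m%n 1 y q ⟩
      1 % q                    ≡⟨ m<n⇒m%n≡m (nonTrivial⇒n>1 q) ⟩
      1                        ∎
      where open ≡-Reasoning

    a≡a/q*q+1 : a ≡ a / q * q + 1
    a≡a/q*q+1 = trans (m≡m%n+[m/n]*n a q) (trans (cong (_+ a / q * q) a%q≡1) (+-comm 1 _))

  multiples-complement : ∀ {k n} p → k ≤ n → k * p + (n ∸ k) * p ≡ n * p
  multiples-complement {k} {n} p k≤n =
    trans (sym (*-distribʳ-+ p k (n ∸ k))) (cong (_* p) (m+[n∸m]≡n k≤n))

  positive-multiple-≥ : ∀ {a} p k → a ≡ k * p → 0 < a → p ≤ a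
  positive-multiple-≥ p zero    refl ()
  positive-multiple-≥ p (suc k) refl _ = m≤m+n p (k * p)

  -- The lifts of (0,1) and (1,0) sum to pq + 1: b = pq + 1 - a is the lift of (1,0).
  complement : ∀ p q a → .{{NonTrivial p}} → Lift₀₁ p q a →
               ∃ λ b → Lift₀₁ q p b × a + b ≡ suc (p * q)
  complement p q a (a<pq , (k , a≡kp+0) , (j , a≡jq+1)) =
    b , (b<qp , (p ∸ j , b≡[p-j]q+0) , (q ∸ k , refl)) , a+b≡1+pq
    where
    b : ℕ
    b = (q ∸ k) * p + 1

    a≡kp : a ≡ k * p
    a≡kp = trans a≡kp+0 (+-identityʳ _)

    a≡1+jq : a ≡ suc (j * q)
    a≡1+jq = trans a≡jq+1 (+-comm _ 1)

    k<q : k < q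
    k<q = *-cancelʳ-< p k q (subst₂ _<_ a≡kp (*-comm p q) a<pq)

    j<p : j < p
    j<p = *-cancelʳ-< q j p (<-trans (subst (j * q <_) (sym a≡1+jq) (n<1+n _)) a<pq)

    a+b≡1+pq : a + b ≡ suc (p * q)
    a+b≡1+pq = begin
      a + ((q ∸ k) * p + 1)      ≡⟨ cong (_+ b) a≡kp ⟩
      k * p + ((q ∸ k) * p + 1)  ≡⟨ sym (+-assoc (k * p) _ 1) ⟩
      k * p + (q ∸ k) * p + 1    ≡⟨ cong (_+ 1) (multiples-complement p (<⇒≤ k<q)) ⟩
      q * p + 1                  ≡⟨ +-comm (q * p) 1 ⟩
      suc (q * p)                ≡⟨ cong suc (*-comm q p) ⟩
      suc (p * q)                ∎
      where open ≡-Reasoning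

    a+[p-j]q≡1+pq : a + ((p ∸ j) * q + 0) ≡ suc (p * q)
    a+[p-j]q≡1+pq = begin
      a + ((p ∸ j) * q + 0)     ≡⟨ cong₂ _+_ a≡1+jq (+-identityʳ _) ⟩
      suc (j * q + (p ∸ j) * q) ≡⟨ cong suc (multiples-complement q (<⇒≤ j<p)) ⟩
      suc (p * q)               ∎
      where open ≡-Reasoning

    b≡[p-j]q+0 : b ≡ (p ∸ j) * q + 0
    b≡[p-j]q+0 = +-cancelˡ-≡ a b _ (trans a+b≡1+pq (sym a+[p-j]q≡1+pq))

    -- a is a nonzero multiple of p, hence at least p ≥ 2
    2≤a : 2 ≤ a
    2≤a = ≤-trans (nonTrivial⇒n>1 p) (positive-multiple-≥ p k a≡kp (subst (0 <_) (sym a≡1+jq) z<s))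

    b<qp : b < q * p
    b<qp = subst (b <_) (*-comm p q) (≤-pred (subst (2 + b ≤_) a+b≡1+pq (+-monoˡ-≤ b 2≤a)))

  -- For coprime p, q > 1 the canonical set contains elements a, b with a + b = pq + 1
  -- (the lifts of (0,1) and (1,0)); Bézout's identity provides one of them.
  canonical-pair : ∀ p q → .{{NonTrivial p}} → .{{NonTrivial q}} → Coprime p q →
    ∃₂ λ a b → InCanonicalSet p q a × InCanonicalSet p q b × a + b ≡ suc (p * q)
  canonical-pair p q p⊥q with coprime-Bézout p⊥q
  ... | Bézout.+- x y 1+yq≡xp =
    let a , a-lift@(a<pq , a≡0 , a≡1) = bézout⇒lift p q x y (sym 1+yq≡xp)
        b , (b<qp , b≡0 , b≡1) , a+b≡1+pq = complement p q a a-lift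
    in a , b , (a<pq , inj₂ (inj₁ (a≡0 , a≡1)))
             , (subst (b <_) (*-comm q p) b<qp , inj₂ (inj₂ (b≡1 , b≡0)))
             , a+b≡1+pq
  ... | Bézout.-+ x y 1+xp≡yq =
    let b , b-lift@(b<qp , b≡0 , b≡1) = bézout⇒lift q p y x (sym 1+xp≡yq)
        a , (a<pq , a≡0 , a≡1) , b+a≡1+qp = complement q p b b-lift
    in a , b , (a<pq , inj₂ (inj₁ (a≡0 , a≡1)))
             , (subst (b <_) (*-comm q p) b<qp , inj₂ (inj₂ (b≡1 , b≡0)))
             , trans (+-comm a b) (trans b+a≡1+qp (cong suc (*-comm q p)))

  one∈canonical : ∀ p q → .{{NonTrivial p}} → .{{NonTrivial q}} → InCanonicalSet p q 1
  one∈canonical p q = 1<pq , inj₁ ((0 , refl) , (0 , refl))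
    where
    instance
      q≢0 : NonZero q
      q≢0 = nonTrivial⇒nonZero q
    1<pq : 1 < p * q
    1<pq = <-≤-trans (nonTrivial⇒n>1 p) (m≤m*n p q)

module RingFacts {c ℓ} (F : CommutativeRing c ℓ) where
  open import Data.Nat as ℕ using (zero; suc)
  import Data.Nat.Properties as ℕ
  import Data.Fin as Fin
  open import Data.Product using (_,_; proj₁; proj₂)
  open import Relation.Nullary using (¬_; Dec; yes; no)
  open import Relation.Binary.PropositionalEquality as ≡ using (_≡_)
  open CommutativeRing F
  open import Algebra.Properties.CommutativeSemiring.Exp commutativeSemiring
    using (_^_; ^-congˡ; ^-homo-*; ^-assocʳ; ^-distrib-*)
  open import Relation.Binary.Reasoning.Setoid setoid

  pow≈^ : ∀ x n → pow F x n ≈ x ^ n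
  pow≈^ x zero    = refl
  pow≈^ x (suc n) = *-congˡ (pow≈^ x n)

  pow-congˡ : ∀ {x y} n → x ≈ y → pow F x n ≈ pow F y n
  pow-congˡ {x} {y} n x≈y = begin
    pow F x n  ≈⟨ pow≈^ x n ⟩
    x ^ n      ≈⟨ ^-congˡ n x≈y ⟩
    y ^ n      ≈⟨ pow≈^ y n ⟨
    pow F y n  ∎

  pow-homo-+ : ∀ x m n → pow F x (m ℕ.+ n) ≈ pow F x m * pow F x n
  pow-homo-+ x m n = begin
    pow F x (m ℕ.+ n)      ≈⟨ pow≈^ x (m ℕ.+ n) ⟩
    x ^ (m ℕ.+ n)          ≈⟨ ^-homo-* x m n ⟩
    x ^ m * x ^ n          ≈⟨ *-cong (pow≈^ x m) (pow≈^ x n) ⟨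
    pow F x m * pow F x n  ∎

  pow-distrib-* : ∀ x y n → pow F (x * y) n ≈ pow F x n * pow F y n
  pow-distrib-* x y n = begin
    pow F (x * y) n        ≈⟨ pow≈^ (x * y) n ⟩
    (x * y) ^ n            ≈⟨ ^-distrib-* x y n ⟩
    x ^ n * y ^ n          ≈⟨ *-cong (pow≈^ x n) (pow≈^ y n) ⟨
    pow F x n * pow F y n  ∎

  pow-assoc : ∀ x m n → pow F (pow F x m) n ≈ pow F x (m ℕ.* n)
  pow-assoc x m n = begin
    pow F (pow F x m) n  ≈⟨ pow≈^ (pow F x m) n ⟩
    pow F x m ^ n        ≈⟨ ^-congˡ n (pow≈^ x m) ⟩
    (x ^ m) ^ n          ≈⟨ ^-assocʳ x m n ⟩
    x ^ (m ℕ.* n)        ≈⟨ pow≈^ x (m ℕ.* n) ⟨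
    pow F x (m ℕ.* n)    ∎

  pow-pow-comm : ∀ x m n → pow F (pow F x m) n ≈ pow F (pow F x n) m
  pow-pow-comm x m n = begin
    pow F (pow F x m) n  ≈⟨ pow-assoc x m n ⟩
    pow F x (m ℕ.* n)    ≡⟨ ≡.cong (pow F x) (ℕ.*-comm m n) ⟩
    pow F x (n ℕ.* m)    ≈⟨ pow-assoc x n m ⟨
    pow F (pow F x n) m  ∎

  pow-1# : ∀ n → pow F 1# n ≈ 1#
  pow-1# zero    = refl
  pow-1# (suc n) = trans (*-identityˡ _) (pow-1# n)

  pow-unit : ∀ {x y} n → x * y ≈ 1# → pow F x n * pow F y n ≈ 1#
  pow-unit {x} {y} n xy≈1 = begin
    pow F x n * pow F y n  ≈⟨ pow-distrib-* x y n ⟨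
    pow F (x * y) n        ≈⟨ pow-congˡ n xy≈1 ⟩
    pow F 1# n             ≈⟨ pow-1# n ⟩
    1#                     ∎

  root-of-unity-unit : ∀ {x} m → .{{ℕ.NonZero m}} → pow F x m ≈ 1# → x * pow F x (ℕ.pred m) ≈ 1#
  root-of-unity-unit {x} m xᵐ≈1 = trans (reflexive (≡.cong (pow F x) (ℕ.suc-pred m))) xᵐ≈1

  idempotent-unit≈1 : ∀ {z z⁻¹} → z * z ≈ z → z * z⁻¹ ≈ 1# → z ≈ 1#
  idempotent-unit≈1 {z} {z⁻¹} zz≈z zz⁻¹≈1 = begin
    z              ≈⟨ *-identityʳ z ⟨
    z * 1#         ≈⟨ *-congˡ zz⁻¹≈1 ⟨
    z * (z * z⁻¹)  ≈⟨ *-assoc z z z⁻¹ ⟨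
    (z * z) * z⁻¹  ≈⟨ *-congʳ zz≈z ⟩
    z * z⁻¹        ≈⟨ zz⁻¹≈1 ⟩
    1#             ∎

  -- If z is a unit with zᵐ = 1 and a + b = m + 1, then zᵃ = zᵇ = z forces z = 1,
  -- since then z² = zᵃ zᵇ = z^(m+1) = z.
  exponent-collapse : ∀ {z z⁻¹} m a b → z * z⁻¹ ≈ 1# → pow F z m ≈ 1# →
    a ℕ.+ b ≡ suc m → pow F z a ≈ z → pow F z b ≈ z → z ≈ 1#
  exponent-collapse {z} {z⁻¹} m a b zz⁻¹≈1 zᵐ≈1 a+b≡1+m zᵃ≈z zᵇ≈z =
    idempotent-unit≈1 zz≈z zz⁻¹≈1
    where
    zz≈z : z * z ≈ z
    zz≈z = begin
      z * z                  ≈⟨ *-cong zᵃ≈z zᵇ≈z ⟨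
      pow F z a * pow F z b  ≈⟨ pow-homo-+ z a b ⟨
      pow F z (a ℕ.+ b)      ≡⟨ ≡.cong (pow F z) a+b≡1+m ⟩
      z * pow F z m          ≈⟨ *-congˡ zᵐ≈1 ⟩
      z * 1#                 ≈⟨ *-identityʳ z ⟩
      z                      ∎

  finite⇒≈-decidable : ∀ {n} → HasCardinality F n → ∀ x y → Dec (x ≈ y)
  finite⇒≈-decidable (f , onto , injective) x y with onto x | onto y
  ... | i , fi≈x | j , fj≈y with i Fin.≟ j
  ...   | yes ≡.refl = yes (trans (sym fi≈x) fj≈y)
  ...   | no i≢j     = no (λ x≈y → i≢j (injective i j (trans fi≈x (trans x≈y (sym fj≈y)))))

  module CharTwo (char2 : HasChar2 F) where

    x+x≈0 : ∀ x → x + x ≈ 0#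
    x+x≈0 x = begin
      x + x              ≈⟨ +-cong (*-identityʳ x) (*-identityʳ x) ⟨
      x * 1# + x * 1#    ≈⟨ distribˡ x 1# 1# ⟨
      x * (1# + 1#)      ≈⟨ *-congˡ char2 ⟩
      x * 0#             ≈⟨ zeroʳ x ⟩
      0#                 ∎

    x+y≈0⇒x≈y : ∀ {x y} → x + y ≈ 0# → x ≈ y
    x+y≈0⇒x≈y {x} {y} x+y≈0 = begin
      x              ≈⟨ +-identityʳ x ⟨
      x + 0#         ≈⟨ +-congˡ (x+x≈0 y) ⟨
      x + (y + y)    ≈⟨ +-assoc x y y ⟨
      (x + y) + y    ≈⟨ +-congʳ x+y≈0 ⟩
      0# + y         ≈⟨ +-identityˡ y ⟩
      y              ∎

  module Field (isField : IsField F) where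

    0≉1 : ¬ (0# ≈ 1#)
    0≉1 = proj₁ isField

    unit⇒≉0 : ∀ {x y} → x * y ≈ 1# → ¬ (x ≈ 0#)
    unit⇒≉0 {x} {y} xy≈1 x≈0 = 0≉1 (trans (sym (zeroˡ y)) (trans (*-congʳ (sym x≈0)) xy≈1))

    *-cancelˡ : ∀ {d x y} → ¬ (d ≈ 0#) → d * x ≈ d * y → x ≈ y
    *-cancelˡ {d} {x} {y} d≉0 dx≈dy with proj₂ isField d d≉0
    ... | d⁻¹ , dd⁻¹≈1 = begin
      x                ≈⟨ *-identityˡ x ⟨
      1# * x           ≈⟨ *-congʳ (trans (*-comm d⁻¹ d) dd⁻¹≈1) ⟨
      (d⁻¹ * d) * x    ≈⟨ *-assoc d⁻¹ d x ⟩
      d⁻¹ * (d * x)    ≈⟨ *-congˡ dx≈dy ⟩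
      d⁻¹ * (d * y)    ≈⟨ *-assoc d⁻¹ d y ⟨
      (d⁻¹ * d) * y    ≈⟨ *-congʳ (trans (*-comm d⁻¹ d) dd⁻¹≈1) ⟩
      1# * y           ≈⟨ *-identityˡ y ⟩
      y                ∎

module Sparsity {c ℓ} (F : CommutativeRing c ℓ) where
  open import Level using (_⊔_)
  open import Data.Nat using (suc; z≤n; s≤s)
  open import Data.Fin as Fin using (Fin)
  open import Data.List using ([]; _∷_; length; lookup)
  open import Data.Product using (∃; _,_)
  open import Data.Sum using (_⊎_; inj₁; inj₂)
  open import Relation.Nullary using (¬_; Dec; yes; no)
  open CommutativeRing F hiding (zero)
  open import Relation.Binary.Reasoning.Setoid setoid

  Binomial : Poly F → Set (c ⊔ ℓ)
  Binomial P = ∃ λ n → ∃ λ e → ∃ λ u → ∃ λ v →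
    ∀ x → eval F P x ≈ pow F x n * (u + v * pow F x e)

  NonzeroAt : (P : Poly F) → Fin (length P) → Set ℓ
  NonzeroAt P i = ¬ (lookup P i ≈ 0#)

  -- The
  -- witnesses are what lets a nonzero constant term raise the count by one.
  data Shape (P : Poly F) : Set (c ⊔ ℓ) where
    vanishing : (∀ x → eval F P x ≈ 0#) → Shape P
    monomial  : ∀ n u → (∀ x → eval F P x ≈ pow F x n * u) →
                ∀ i → NonzeroAt P i → Shape P
    binomial  : ∀ n e u v → (∀ x → eval F P x ≈ pow F x n * (u + v * pow F x e)) →
                ∀ i j → i Fin.< j → NonzeroAt P i → NonzeroAt P j → Shape P
    many      : AtLeastThreeMonomials F P → Shape P

  eval-zero-tail : ∀ a as → (∀ x → eval F as x ≈ 0#) → ∀ x → eval F (a ∷ as) x ≈ a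
  eval-zero-tail a as as≈0 x = begin
    a + x * eval F as x  ≈⟨ +-congˡ (*-congˡ (as≈0 x)) ⟩
    a + x * 0#           ≈⟨ +-congˡ (zeroʳ x) ⟩
    a + 0#               ≈⟨ +-identityʳ a ⟩
    a                    ∎

  eval-shift : ∀ a as n (g : Carrier → Carrier) → a ≈ 0# →
    (∀ x → eval F as x ≈ pow F x n * g x) → ∀ x → eval F (a ∷ as) x ≈ pow F x (suc n) * g x
  eval-shift a as n g a≈0 as≈ x = begin
    a + x * eval F as x         ≈⟨ +-cong a≈0 (*-congˡ (as≈ x)) ⟩
    0# + x * (pow F x n * g x)  ≈⟨ +-identityˡ _ ⟩
    x * (pow F x n * g x)       ≈⟨ *-assoc x (pow F x n) (g x) ⟨
    pow F x (suc n) * g x       ∎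

  eval-prepend : ∀ a as n u → (∀ x → eval F as x ≈ pow F x n * u) →
    ∀ x → eval F (a ∷ as) x ≈ pow F x 0 * (a + u * pow F x (suc n))
  eval-prepend a as n u as≈ x = begin
    a + x * eval F as x             ≈⟨ +-congˡ (*-congˡ (as≈ x)) ⟩
    a + x * (pow F x n * u)         ≈⟨ +-congˡ (*-assoc x (pow F x n) u) ⟨
    a + pow F x (suc n) * u         ≈⟨ +-congˡ (*-comm (pow F x (suc n)) u) ⟩
    a + u * pow F x (suc n)         ≈⟨ *-identityˡ _ ⟨
    1# * (a + u * pow F x (suc n))  ∎

  many-cons : ∀ {a as} → AtLeastThreeMonomials F as → AtLeastThreeMonomials F (a ∷ as)
  many-cons (i , j , k , i<j , j<k , i≉0 , j≉0 , k≉0) =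
    Fin.suc i , Fin.suc j , Fin.suc k , s≤s i<j , s≤s j<k , i≉0 , j≉0 , k≉0

  monomial⇒binomial : ∀ {P} n u → (∀ x → eval F P x ≈ pow F x n * u) → Binomial P
  monomial⇒binomial n u P≈ = n , 0 , u , 0# , λ x → trans (P≈ x) (*-congˡ (u≈u+0x⁰ x))
    where
    u≈u+0x⁰ : ∀ x → u ≈ u + 0# * pow F x 0
    u≈u+0x⁰ x = sym (trans (+-congˡ (zeroˡ _)) (+-identityʳ u))

  module _ (≈0? : ∀ x → Dec (x ≈ 0#)) where

    shape : ∀ P → Shape P
    shape []       = vanishing (λ _ → refl)
    shape (a ∷ as) with ≈0? a | shape as
    ... | yes a≈0 | vanishing as≈0 =
      vanishing (λ x → trans (eval-zero-tail a as as≈0 x) a≈0)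
    ... | yes a≈0 | monomial n u as≈ i i≉0 =
      monomial (suc n) u (eval-shift a as n (λ _ → u) a≈0 as≈) (Fin.suc i) i≉0
    ... | yes a≈0 | binomial n e u v as≈ i j i<j i≉0 j≉0 =
      binomial (suc n) e u v (eval-shift a as n (λ x → u + v * pow F x e) a≈0 as≈)
               (Fin.suc i) (Fin.suc j) (s≤s i<j) i≉0 j≉0
    ... | yes _   | many as-many = many (many-cons as-many)
    ... | no a≉0  | vanishing as≈0 =
      monomial 0 a (λ x → trans (eval-zero-tail a as as≈0 x) (sym (*-identityˡ a))) Fin.zero a≉0
    ... | no a≉0  | monomial n u as≈ i i≉0 =
      binomial 0 (suc n) a u (eval-prepend a as n u as≈) Fin.zero (Fin.suc i) (s≤s z≤n) a≉0 i≉0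
    ... | no a≉0  | binomial _ _ _ _ _ i j i<j i≉0 j≉0 =
      many (Fin.zero , Fin.suc i , Fin.suc j , s≤s z≤n , s≤s i<j , a≉0 , i≉0 , j≉0)
    ... | no a≉0  | many (i , j , _ , i<j , _ , i≉0 , j≉0 , _) =
      many (Fin.zero , Fin.suc i , Fin.suc j , s≤s z≤n , s≤s i<j , a≉0 , i≉0 , j≉0)

    many-or-binomial : ∀ P → AtLeastThreeMonomials F P ⊎ Binomial P
    many-or-binomial P with shape P
    ... | vanishing P≈0 =
      inj₂ (monomial⇒binomial {P} 0 0# (λ x → trans (P≈0 x) (sym (*-identityˡ 0#))))
    ... | monomial n u P≈ _ _           = inj₂ (monomial⇒binomial {P} n u P≈)
    ... | binomial n e u v P≈ _ _ _ _ _ = inj₂ (n , e , u , v , P≈)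
    ... | many P-many                   = inj₁ P-many

module Decoding {c ℓ} (F : CommutativeRing c ℓ) (isField : IsField F) (char2 : HasChar2 F) where
  open import Data.Nat as ℕ using (suc)
  open import Data.Product using (_,_)
  open import Data.Empty using (⊥)
  open import Relation.Nullary using (¬_)
  open import Relation.Binary.PropositionalEquality using (_≡_)
  open CommutativeRing F
  open RingFacts F
  open CharTwo char2
  open Field isField
  open Sparsity F using (Binomial)
  open import Relation.Binary.Reasoning.Setoid setoid

  -- At a unit root w of xⁿ (u + v xᵉ) we get u = v wᵉ (in characteristic 2, -1 = 1).
  binomial-root : ∀ P n e {u v} w {w⁻¹} →
    (∀ x → eval F P x ≈ pow F x n * (u + v * pow F x e)) →
    w * w⁻¹ ≈ 1# → eval F P w ≈ 0# → u ≈ v * pow F w e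
  binomial-root P n e {u} {v} w P≈ ww⁻¹≈1 Pw≈0 =
    x+y≈0⇒x≈y (*-cancelˡ (unit⇒≉0 (pow-unit n ww⁻¹≈1)) wⁿ[u+vwᵉ]≈wⁿ0)
    where
    wⁿ[u+vwᵉ]≈wⁿ0 : pow F w n * (u + v * pow F w e) ≈ pow F w n * 0#
    wⁿ[u+vwᵉ]≈wⁿ0 = trans (sym (P≈ w)) (trans Pw≈0 (sym (zeroʳ _)))

  -- Let γ be a unit with γᵐ = 1 and a + b = m + 1. A polynomial xⁿ (u + v xᵉ) with
  -- value 1 at 1 cannot vanish at γ, γᵃ and γᵇ: with z = γᵉ the three roots give
  -- u = v z = v zᵃ = v zᵇ, so v ≠ 0 forces zᵃ = zᵇ = z, hence z = 1, u = v and
  -- u + v = 0.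
  binomial-not-decoding : ∀ P {m} a b {γ γ⁻¹} → a ℕ.+ b ≡ suc m →
    pow F γ m ≈ 1# → γ * γ⁻¹ ≈ 1# → Binomial P → eval F P 1# ≈ 1# →
    eval F P (pow F γ 1) ≈ 0# → eval F P (pow F γ a) ≈ 0# → eval F P (pow F γ b) ≈ 0# → ⊥
  binomial-not-decoding P {m} a b {γ} {γ⁻¹} a+b≡1+m γᵐ≈1 γγ⁻¹≈1 (n , e , u , v , P≈)
                        P1≈1 Pγ≈0 Pγᵃ≈0 Pγᵇ≈0 = 0≉1 0≈1
    where
    z : Carrier
    z = pow F γ e

    root : ∀ s → eval F P (pow F γ s) ≈ 0# → u ≈ v * pow F z s
    root s Pγˢ≈0 = trans (binomial-root P n e (pow F γ s) P≈ (pow-unit s γγ⁻¹≈1) Pγˢ≈0)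
                         (*-congˡ (pow-pow-comm γ s e))

    u≈vz : u ≈ v * z
    u≈vz = trans (root 1 Pγ≈0) (*-congˡ (*-identityʳ z))

    u+v≈1 : u + v ≈ 1#
    u+v≈1 = begin
      u + v                              ≈⟨ +-congˡ (trans (*-congˡ (pow-1# e)) (*-identityʳ v)) ⟨
      u + v * pow F 1# e                 ≈⟨ *-identityˡ _ ⟨
      1# * (u + v * pow F 1# e)          ≈⟨ *-congʳ (pow-1# n) ⟨
      pow F 1# n * (u + v * pow F 1# e)  ≈⟨ P≈ 1# ⟨
      eval F P 1#                        ≈⟨ P1≈1 ⟩
      1#                                 ∎

    v≉0 : ¬ (v ≈ 0#)
    v≉0 v≈0 = 0≉1 (begin
      0#       ≈⟨ +-identityʳ 0# ⟨
      0# + 0#  ≈⟨ +-cong (trans u≈vz (trans (*-congʳ v≈0) (zeroˡ z))) v≈0 ⟨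
      u + v    ≈⟨ u+v≈1 ⟩
      1#       ∎)

    zˢ≈z : ∀ s → eval F P (pow F γ s) ≈ 0# → pow F z s ≈ z
    zˢ≈z s Pγˢ≈0 = *-cancelˡ v≉0 (trans (sym (root s Pγˢ≈0)) u≈vz)

    zᵐ≈1 : pow F z m ≈ 1#
    zᵐ≈1 = trans (pow-pow-comm γ e m) (trans (pow-congˡ e γᵐ≈1) (pow-1# e))

    z≈1 : z ≈ 1#
    z≈1 = exponent-collapse m a b (pow-unit e γγ⁻¹≈1) zᵐ≈1 a+b≡1+m (zˢ≈z a Pγᵃ≈0) (zˢ≈z b Pγᵇ≈0)

    0≈1 : 0# ≈ 1#
    0≈1 = begin
      0#      ≈⟨ x+x≈0 v ⟨
      v + v   ≈⟨ +-congʳ (trans u≈vz (trans (*-congˡ z≈1) (*-identityʳ v))) ⟨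
      u + v   ≈⟨ u+v≈1 ⟩
      1#      ∎

open import Level using (Level)
open import Data.Nat using (ℕ; _^_; _*_; NonZero; NonTrivial)
open import Data.Nat.Properties using (m*n≢0)
open import Data.Nat.Primality using (Prime; prime⇒nonTrivial; prime⇒nonZero)
open import Data.Sum using ([_,_]′)
open import Data.Empty using (⊥; ⊥-elim)
open import Data.Product using (_,_)
open import Function using (id; _∘_)
open import Relation.Nullary using (¬_)
open import Relation.Binary.PropositionalEquality using (_≡_)
open CanonicalSetArithmetic using (distinct-primes-coprime; canonical-pair; one∈canonical)
open RingFacts using (root-of-unity-unit; finite⇒≈-decidable)
open Sparsity using (Binomial; many-or-binomial)
open Decoding using (binomial-not-decoding)

proposition3p1 : {c ℓ : Level} (p q : ℕ) → Prime p → Prime q → Odd p → Odd q → ¬ (p ≡ q)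
    → (t : ℕ) → IsMultOrderOf2 (p * q) t
    → (F : CommutativeRing c ℓ) → IsField F → HasChar2 F → HasCardinality F (2 ^ t)
    → (γ : CommutativeRing.Carrier F) → IsPrimitiveRoot F (p * q) γ
    → (P : Poly F) → IsDecodingPoly F p q γ P
    → AtLeastThreeMonomials F P
proposition3p1 p q p-prime q-prime _ _ p≢q _ _ F F-field F-char2 F-finite γ (γᵐ≈1 , _) P
               (P-vanishes , P1≈1) =
  [ id , ⊥-elim ∘ binomial-impossible ]′
    (many-or-binomial F (λ x → finite⇒≈-decidable F F-finite x (CommutativeRing.0# F)) P)
  where
  instance
    p-nontrivial : NonTrivial p
    p-nontrivial = prime⇒nonTrivial p-prime
    q-nontrivial : NonTrivial q
    q-nontrivial = prime⇒nonTrivial q-prime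
    pq≢0 : NonZero (p * q)
    pq≢0 = m*n≢0 p q {{prime⇒nonZero p-prime}} {{prime⇒nonZero q-prime}}

  binomial-impossible : Binomial F P → ⊥
  binomial-impossible P-binomial =
    let a , b , a∈S , b∈S , a+b≡1+pq = canonical-pair p q (distinct-primes-coprime p-prime q-prime p≢q)
    in binomial-not-decoding F F-field F-char2 P a b a+b≡1+pq γᵐ≈1
         (root-of-unity-unit F (p * q) γᵐ≈1) P-binomial P1≈1
         (P-vanishes 1 (one∈canonical p q)) (P-vanishes a a∈S) (P-vanishes b b∈S)
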